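{- Let $G$ be a quasi-regularizable graph of order $n\geq 2$ with independence number $\alpha=\alpha(G)$, and let $s_k$ denote the number of independent sets of size $k$ in $G$. Then: (i) $(k+1)\cdot s_{k+1}\leq (n-2k)\cdot s_k$ for every $1\leq k<\alpha$; (ii) $s_{\lceil \frac{n-1}{3}\rceil}\geq s_{\lceil \frac{n-1}{3}\rceil+1}\geq\cdots\geq s_{\alpha}$.
   Context: All graphs are finite and simple. An independent set is a set of pairwise non-adjacent vertices; $\alpha(G)$ is the maximum size of an independent set. For $A\subseteq V(G)$, $N(A)$ is the set of vertices adjacent to at least one vertex of $A$. A graph $G$ is quasi-regularizable if $|S|\leq|N(S)|$ for every independent set $S$ of $G$. -}

module Defs where

open import Data.Nat using (ℕ; zero; suc)
open import Data.Bool using (Bool; true; false)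
open import Data.Fin using (Fin)
open import Data.Fin.Subset using (Subset; _∈_; ∣_∣)
open import Data.Vec using (Vec; []; _∷_)
open import Data.List using (List; []; _∷_; map; _++_; filter; length)
open import Data.Product using (Σ; ∃; _×_; _,_)
open import Relation.Binary.PropositionalEquality using (_≡_)
open import Relation.Nullary using (¬_; Dec)
open import Relation.Nullary.Decidable using (_×-dec_)
open import Data.Nat using (_≟_)
import Data.Nat
open import Data.Fin.Properties using (all?)
open import Data.Fin.Subset.Properties using (_∈?_)
open import Relation.Nullary.Decidable using (_→-dec_; ¬?)

record Graph (n : ℕ) : Set₁ where
  field
    Adj       : Fin n → Fin n → Set
    Adj?      : ∀ u v → Dec (Adj u v)
    Adj-sym   : ∀ {u v} → Adj u v → Adj v u
    Adj-irrefl : ∀ {u} → ¬ Adj u u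
open Graph public

Independent : ∀ {n} → Graph n → Subset n → Set
Independent G S = ∀ u v → u ∈ S → v ∈ S → ¬ Adj G u v

_∈N[_]_ : ∀ {n} → Fin n → Graph n → Subset n → Set
v ∈N[ G ] A = ∃ λ u → u ∈ A × Adj G u v


QuasiRegularizable : ∀ {n} → Graph n → Set
QuasiRegularizable {n} G =
  ∀ (S : Subset n) → Independent G S →
    ∀ (T : Subset n) → (∀ v → (v ∈ T → v ∈N[ G ] S) × (v ∈N[ G ] S → v ∈ T)) →
      ∣ S ∣ Data.Nat.≤ ∣ T ∣

allSubsets : (n : ℕ) → List (Subset n)
allSubsets zero = [] ∷ []
allSubsets (suc n) = map (true ∷_) (allSubsets n) ++ map (false ∷_) (allSubsets n)

indepCount : ∀ {n} → Graph n → ℕ → ℕ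
indepCount {n} G k = length (filter P? (allSubsets n))
  where
  P : Subset n → Set
  P S = Independent G S × ∣ S ∣ ≡ k
  P? : ∀ S → Dec (P S)
  P? S = indep? ×-dec (∣ S ∣ ≟ k)
    where
    indep? : Dec (Independent G S)
    indep? = all? λ u → all? λ v →
      (u ∈? S) →-dec ((v ∈? S) →-dec ¬? (Adj? G u v))

IsIndependenceNumber : ∀ {n} → Graph n → ℕ → Set
IsIndependenceNumber {n} G a =
  (Σ (Subset n) λ S → Independent G S × ∣ S ∣ ≡ a) ×
  (∀ (S : Subset n) → Independent G S → ∣ S ∣ Data.Nat.≤ a)

⌈_/3⌉ : ℕ → ℕ
⌈ m /3⌉ = (m Data.Nat.+ 2) Data.Nat./ 3

module Submission where

-- Double counting: (k + 1) s_{k+1} counts the pairs (S , v) with S an independent k-set and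
-- S ∪ {v} an independent (k + 1)-set. Such a v lies outside S ∪ N(S), a disjoint union whose
-- size is at least 2k because quasi-regularizability gives |N(S)| ≥ |S| = k. Hence each S has
-- at most n − 2k such v, and (ii) follows from (i) because n − 2k ≤ k + 1 once k ≥ ⌈(n − 1)/3⌉.

open import Defs
open import Data.Nat using (ℕ; _+_; _*_; _∸_; _≤_; _<_; _≥_)
open import Data.Product using (_×_)

open import Data.Nat.Properties
open import Algebra.Properties.CommutativeMonoid.Sum +-0-commutativeMonoid
  using (sum; sum-syntax; sum-replicate-zero)
open import Algebra.Properties.CommutativeSemigroup +-commutativeSemigroup
  using (interchange; xy∙z≈y∙xz)
open import Data.Bool using (true; false; if_then_else_)
open import Data.Fin using (Fin; zero; suc)
open import Data.Fin.Properties using (all?; any?) renaming (_≟_ to _≟ᶠ_)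
open import Data.Fin.Subset using (Subset; _∈_; _∉_; _⊆_; ∁; _∪_; _∩_; ∣_∣; Empty)
open import Data.Fin.Subset.Properties
  using (_∈?_; drop-∷-Empty; ∣∁p∣≡n∸∣p∣; x∉p⇒x∈∁p; x∈p∪q⁻; x∈p∩q⁻)
open import Data.List using (List; map; _++_; filter; length)
open import Data.List.Properties using (filter-++; length-++)
open import Data.Nat using (zero; suc; z≤n; _%_; _≟_; >-nonZero)
open import Data.Nat.DivMod using (m≡m%n+[m/n]*n; m%n<n)
open import Data.Nat.Tactic.RingSolver using (solve-∀)
open import Data.Product using (_,_)
open import Data.Sum using ([_,_])
open import Data.Vec using ([]; _∷_; here; there; lookup; tabulate; _[_]≔_)
open import Data.Vec.Properties
  using (lookup⇒[]=; []=⇒lookup; lookup∘tabulate; []≔-updates; []≔-minimal)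
open import Function using (_∘_)
open import Relation.Binary.PropositionalEquality using (_≡_; _≗_; refl; sym; trans; cong; cong₂; subst; module ≡-Reasoning)
open import Relation.Nullary using (¬_; Dec; yes; no; does; contradiction)
open import Relation.Nullary.Decidable using (_×-dec_; _→-dec_; ¬?; dec-true)
open import Relation.Unary using (Pred; Decidable)

𝟙 : ∀ {a} {A : Set a} → Dec A → ℕ
𝟙 a? = if does a? then 1 else 0

𝟙-yes : ∀ {a} {A : Set a} (a? : Dec A) → A → 𝟙 a? ≡ 1
𝟙-yes a? a = cong (λ b → if b then 1 else 0) (dec-true a? a)

*𝟙-cong : ∀ {a} {A : Set a} {m m′} → (A → m ≡ m′) → (a? : Dec A) → m * 𝟙 a? ≡ m′ * 𝟙 a?
*𝟙-cong m≡m′ (yes a) = cong (_* 1) (m≡m′ a)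
*𝟙-cong {m = m} {m′} m≡m′ (no _) = trans (*-zeroʳ m) (sym (*-zeroʳ m′))

sum-mono-≤ : ∀ {n} {f g : Fin n → ℕ} → (∀ v → f v ≤ g v) → sum f ≤ sum g
sum-mono-≤ {zero}  f≤g = z≤n
sum-mono-≤ {suc n} f≤g = +-mono-≤ (f≤g zero) (sum-mono-≤ (f≤g ∘ suc))

∑𝟙∈≡∣∣ : ∀ {n} (p : Subset n) → ∑[ v < n ] 𝟙 (v ∈? p) ≡ ∣ p ∣
∑𝟙∈≡∣∣ []          = refl
∑𝟙∈≡∣∣ (true ∷ p)  = cong suc (∑𝟙∈≡∣∣ p)
∑𝟙∈≡∣∣ (false ∷ p) = ∑𝟙∈≡∣∣ p

Σˢ : ∀ {n} → (Subset n → ℕ) → ℕ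
Σˢ {zero}  f = f []
Σˢ {suc n} f = Σˢ (f ∘ (true ∷_)) + Σˢ (f ∘ (false ∷_))

Σˢ-cong : ∀ {n} {f g : Subset n → ℕ} → f ≗ g → Σˢ f ≡ Σˢ g
Σˢ-cong {zero}  f≗g = f≗g []
Σˢ-cong {suc n} f≗g = cong₂ _+_ (Σˢ-cong (f≗g ∘ (true ∷_))) (Σˢ-cong (f≗g ∘ (false ∷_)))

Σˢ-mono-≤ : ∀ {n} {f g : Subset n → ℕ} → (∀ S → f S ≤ g S) → Σˢ f ≤ Σˢ g
Σˢ-mono-≤ {zero}  f≤g = f≤g []
Σˢ-mono-≤ {suc n} f≤g = +-mono-≤ (Σˢ-mono-≤ (f≤g ∘ (true ∷_))) (Σˢ-mono-≤ (f≤g ∘ (false ∷_)))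

Σˢ-distrib-+ : ∀ {n} (f g : Subset n → ℕ) → Σˢ (λ S → f S + g S) ≡ Σˢ f + Σˢ g
Σˢ-distrib-+ {zero}  f g = refl
Σˢ-distrib-+ {suc n} f g = trans
  (cong₂ _+_ (Σˢ-distrib-+ (f ∘ (true ∷_)) (g ∘ (true ∷_))) (Σˢ-distrib-+ (f ∘ (false ∷_)) (g ∘ (false ∷_))))
  (interchange (Σˢ (f ∘ (true ∷_))) (Σˢ (g ∘ (true ∷_))) (Σˢ (f ∘ (false ∷_))) (Σˢ (g ∘ (false ∷_))))

*-distribˡ-Σˢ : ∀ {n} m (f : Subset n → ℕ) → m * Σˢ f ≡ Σˢ (λ S → m * f S)
*-distribˡ-Σˢ {zero}  m f = refl
*-distribˡ-Σˢ {suc n} m f = trans (*-distribˡ-+ m _ _)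
  (cong₂ _+_ (*-distribˡ-Σˢ m (f ∘ (true ∷_))) (*-distribˡ-Σˢ m (f ∘ (false ∷_))))

length-filter-map : ∀ {a b p} {A : Set a} {B : Set b} {P : Pred B p}
  (P? : Decidable P) (f : A → B) (xs : List A) →
  length (filter P? (map f xs)) ≡ length (filter (P? ∘ f) xs)
length-filter-map P? f List.[] = refl
length-filter-map P? f (x List.∷ xs) with does (P? (f x))
... | true  = cong suc (length-filter-map P? f xs)
... | false = length-filter-map P? f xs

length-filter-allSubsets : ∀ {n p} {P : Pred (Subset n) p} (P? : Decidable P) →
  length (filter P? (allSubsets n)) ≡ Σˢ (𝟙 ∘ P?)
length-filter-allSubsets {zero} P? with does (P? [])
... | true  = refl
... | false = refl
length-filter-allSubsets {suc n} P? = begin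
  length (filter P? (map (true ∷_) (allSubsets n) ++ map (false ∷_) (allSubsets n)))
    ≡⟨ cong length (filter-++ P? (map (true ∷_) (allSubsets n)) _) ⟩
  length (filter P? (map (true ∷_) (allSubsets n)) ++ filter P? (map (false ∷_) (allSubsets n)))
    ≡⟨ length-++ (filter P? (map (true ∷_) (allSubsets n))) ⟩
  length (filter P? (map (true ∷_) (allSubsets n))) + length (filter P? (map (false ∷_) (allSubsets n)))
    ≡⟨ cong₂ _+_ (length-filter-map P? (true ∷_) (allSubsets n)) (length-filter-map P? (false ∷_) (allSubsets n)) ⟩
  length (filter (P? ∘ (true ∷_)) (allSubsets n)) + length (filter (P? ∘ (false ∷_)) (allSubsets n))
    ≡⟨ cong₂ _+_ (length-filter-allSubsets (P? ∘ (true ∷_))) (length-filter-allSubsets (P? ∘ (false ∷_))) ⟩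
  Σˢ (𝟙 ∘ P?) ∎
  where open ≡-Reasoning

Σ-insert : ∀ {n} → (Subset n → ℕ) → Subset n → ℕ
Σ-insert {n} f S = ∑[ v < n ] (if does (v ∈? S) then 0 else f (S [ v ]≔ true))

-- A pair (T , v) with v ∈ T is counted on the right as (T without v , v).
Σˢ-∣∣*≡Σˢ-Σ-insert : ∀ {n} (f : Subset n → ℕ) → Σˢ (λ T → ∣ T ∣ * f T) ≡ Σˢ (Σ-insert f)
Σˢ-∣∣*≡Σˢ-Σ-insert {zero}  f = refl
Σˢ-∣∣*≡Σˢ-Σ-insert {suc n} f = begin
  Σˢ (λ T → f (true ∷ T) + ∣ T ∣ * f (true ∷ T)) + Σˢ (λ T → ∣ T ∣ * f (false ∷ T))
    ≡⟨ cong (_+ Σˢ (λ T → ∣ T ∣ * f (false ∷ T))) (Σˢ-distrib-+ f₁ _) ⟩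
  (Σˢ f₁ + Σˢ (λ T → ∣ T ∣ * f₁ T)) + Σˢ (λ T → ∣ T ∣ * f₀ T)
    ≡⟨ cong₂ (λ a b → (Σˢ f₁ + a) + b) (Σˢ-∣∣*≡Σˢ-Σ-insert f₁) (Σˢ-∣∣*≡Σˢ-Σ-insert f₀) ⟩
  (Σˢ f₁ + Σˢ (Σ-insert f₁)) + Σˢ (Σ-insert f₀)
    ≡⟨ xy∙z≈y∙xz (Σˢ f₁) _ _ ⟩
  Σˢ (Σ-insert f₁) + (Σˢ f₁ + Σˢ (Σ-insert f₀))
    ≡⟨ cong (Σˢ (Σ-insert f₁) +_) (Σˢ-distrib-+ f₁ (Σ-insert f₀)) ⟨
  Σˢ (Σ-insert f ∘ (true ∷_)) + Σˢ (Σ-insert f ∘ (false ∷_)) ∎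
  where
  open ≡-Reasoning
  f₁ f₀ : Subset n → ℕ
  f₁ = f ∘ (true ∷_)
  f₀ = f ∘ (false ∷_)

∣p∪q∣≡∣p∣+∣q∣ : ∀ {n} (p q : Subset n) → Empty (p ∩ q) → ∣ p ∪ q ∣ ≡ ∣ p ∣ + ∣ q ∣
∣p∪q∣≡∣p∣+∣q∣ []          []          _ = refl
∣p∪q∣≡∣p∣+∣q∣ (true ∷ p)  (true ∷ q)  p∩q≡∅ = contradiction (zero , here) p∩q≡∅
∣p∪q∣≡∣p∣+∣q∣ (true ∷ p)  (false ∷ q) p∩q≡∅ = cong suc (∣p∪q∣≡∣p∣+∣q∣ p q (drop-∷-Empty p∩q≡∅))
∣p∪q∣≡∣p∣+∣q∣ (false ∷ p) (true ∷ q)  p∩q≡∅ =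
  trans (cong suc (∣p∪q∣≡∣p∣+∣q∣ p q (drop-∷-Empty p∩q≡∅))) (sym (+-suc ∣ p ∣ ∣ q ∣))
∣p∪q∣≡∣p∣+∣q∣ (false ∷ p) (false ∷ q) p∩q≡∅ = ∣p∪q∣≡∣p∣+∣q∣ p q (drop-∷-Empty p∩q≡∅)

p⊆p[x]≔true : ∀ {n} (p : Subset n) x → p ⊆ p [ x ]≔ true
p⊆p[x]≔true p x {y} y∈p with y ≟ᶠ x
... | yes refl = []≔-updates p x
... | no y≢x   = []≔-minimal p y x y≢x y∈p

∣p[x]≔true∣≡1+∣p∣ : ∀ {n} (p : Subset n) x → x ∉ p → ∣ p [ x ]≔ true ∣ ≡ suc ∣ p ∣
∣p[x]≔true∣≡1+∣p∣ (true ∷ p)  zero    x∉p = contradiction here x∉p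
∣p[x]≔true∣≡1+∣p∣ (false ∷ p) zero    x∉p = refl
∣p[x]≔true∣≡1+∣p∣ (true ∷ p)  (suc x) x∉p = cong suc (∣p[x]≔true∣≡1+∣p∣ p x (x∉p ∘ there))
∣p[x]≔true∣≡1+∣p∣ (false ∷ p) (suc x) x∉p = ∣p[x]≔true∣≡1+∣p∣ p x (x∉p ∘ there)

∈-tabulate-does⁺ : ∀ {n p} {P : Pred (Fin n) p} (P? : Decidable P) {x} → P x → x ∈ tabulate (does ∘ P?)
∈-tabulate-does⁺ P? {x} Px = lookup⇒[]= x _ (trans (lookup∘tabulate (does ∘ P?) x) (dec-true (P? x) Px))

∈-tabulate-does⁻ : ∀ {n p} {P : Pred (Fin n) p} (P? : Decidable P) {x} → x ∈ tabulate (does ∘ P?) → P x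
∈-tabulate-does⁻ P? {x} x∈ with P? x | trans (sym (lookup∘tabulate (does ∘ P?) x)) ([]=⇒lookup x∈)
... | yes Px | _ = Px
... | no _   | ()

m≤⌈m/3⌉*3 : ∀ m → m ≤ ⌈ m /3⌉ * 3
m≤⌈m/3⌉*3 m = +-cancelˡ-≤ 2 m (⌈ m /3⌉ * 3) (begin
  2 + m                         ≡⟨ +-comm 2 m ⟩
  m + 2                         ≡⟨ m≡m%n+[m/n]*n (m + 2) 3 ⟩
  (m + 2) % 3 + ⌈ m /3⌉ * 3     ≤⟨ +-monoˡ-≤ (⌈ m /3⌉ * 3) (≤-pred (m%n<n (m + 2) 3)) ⟩
  2 + ⌈ m /3⌉ * 3               ∎)
  where open ≤-Reasoning

⌈n∸1/3⌉≤k⇒n∸2k≤k+1 : ∀ n k → ⌈ n ∸ 1 /3⌉ ≤ k → n ∸ 2 * k ≤ k + 1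
⌈n∸1/3⌉≤k⇒n∸2k≤k+1 n k ⌈n∸1/3⌉≤k = m≤n+o⇒m∸n≤o n (2 * k) (begin
  n                  ≤⟨ m≤n+m∸n n 1 ⟩
  1 + (n ∸ 1)        ≤⟨ +-monoʳ-≤ 1 (≤-trans (m≤⌈m/3⌉*3 (n ∸ 1)) (*-monoˡ-≤ 3 ⌈n∸1/3⌉≤k)) ⟩
  1 + k * 3          ≡⟨ regroup k ⟩
  2 * k + (k + 1)    ∎)
  where
  open ≤-Reasoning
  regroup : ∀ k → 1 + k * 3 ≡ 2 * k + (k + 1)
  regroup = solve-∀

module _ {n} (G : Graph n) where

  independent? : Decidable (Independent G)
  independent? S = all? λ u → all? λ v → (u ∈? S) →-dec ((v ∈? S) →-dec ¬? (Adj? G u v))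

  independent-⊆ : ∀ {S T} → S ⊆ T → Independent G T → Independent G S
  independent-⊆ S⊆T indT u v u∈S v∈S = indT u v (S⊆T u∈S) (S⊆T v∈S)

  independentOfSize? : ∀ k → Decidable (λ S → Independent G S × ∣ S ∣ ≡ k)
  independentOfSize? k S = independent? S ×-dec (∣ S ∣ ≟ k)

  χ : ℕ → Subset n → ℕ
  χ k S = 𝟙 (independentOfSize? k S)

  -- independentOfSize? k is, definitionally, the decision procedure filtered by indepCount.
  indepCount≡Σˢχ : ∀ k → indepCount G k ≡ Σˢ (χ k)
  indepCount≡Σˢχ k = length-filter-allSubsets (independentOfSize? k)

  ∣∣*χ≡*χ : ∀ k T → ∣ T ∣ * χ k T ≡ k * χ k T
  ∣∣*χ≡*χ k T = *𝟙-cong (λ (_ , ∣T∣≡k) → ∣T∣≡k) (independentOfSize? k T)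

  N : Subset n → Subset n
  N S = tabulate (does ∘ λ v → any? λ u → (u ∈? S) ×-dec Adj? G u v)

  ∈N⁺ : ∀ {S v} → v ∈N[ G ] S → v ∈ N S
  ∈N⁺ {S} = ∈-tabulate-does⁺ (λ v → any? λ u → (u ∈? S) ×-dec Adj? G u v)

  ∈N⁻ : ∀ {S v} → v ∈ N S → v ∈N[ G ] S
  ∈N⁻ {S} = ∈-tabulate-does⁻ (λ v → any? λ u → (u ∈? S) ×-dec Adj? G u v)

  independent⇒S∩N≡∅ : ∀ {S} → Independent G S → Empty (S ∩ N S)
  independent⇒S∩N≡∅ {S} indS (v , v∈S∩NS) with x∈p∩q⁻ S (N S) v∈S∩NS
  ... | v∈S , v∈NS with ∈N⁻ v∈NS
  ...   | u , u∈S , u~v = indS u v u∈S v∈S u~v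

  independent-insert⇒∉N : ∀ S v → Independent G (S [ v ]≔ true) → v ∉ N S
  independent-insert⇒∉N S v indS+v v∈NS with ∈N⁻ v∈NS
  ... | u , u∈S , u~v = indS+v u v (p⊆p[x]≔true S v u∈S) ([]≔-updates S v) u~v

  insert-independentOfSize⁻ : ∀ {k} S v → v ∉ S →
    Independent G (S [ v ]≔ true) × ∣ S [ v ]≔ true ∣ ≡ k + 1 → Independent G S × ∣ S ∣ ≡ k
  insert-independentOfSize⁻ {k} S v v∉S (indS+v , ∣S+v∣≡k+1) =
      independent-⊆ (p⊆p[x]≔true S v) indS+v
    , suc-injective (trans (sym (∣p[x]≔true∣≡1+∣p∣ S v v∉S)) (trans ∣S+v∣≡k+1 (+-comm k 1)))

  Σ-insert-χ≤∣∁[S∪N]∣ : ∀ k S → Σ-insert (χ (k + 1)) S ≤ ∣ ∁ (S ∪ N S) ∣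
  Σ-insert-χ≤∣∁[S∪N]∣ k S = begin
    Σ-insert (χ (k + 1)) S            ≤⟨ sum-mono-≤ (λ v → term≤ v (v ∈? S) (independentOfSize? (k + 1) (S [ v ]≔ true))) ⟩
    ∑[ v < n ] 𝟙 (v ∈? ∁ (S ∪ N S))   ≡⟨ ∑𝟙∈≡∣∣ (∁ (S ∪ N S)) ⟩
    ∣ ∁ (S ∪ N S) ∣                   ∎
    where
    open ≤-Reasoning
    term≤ : ∀ v (v∈?S : Dec (v ∈ S)) (d : Dec (Independent G (S [ v ]≔ true) × ∣ S [ v ]≔ true ∣ ≡ k + 1)) →
      (if does v∈?S then 0 else 𝟙 d) ≤ 𝟙 (v ∈? ∁ (S ∪ N S))
    term≤ v (yes _)   _                = z≤n
    term≤ v (no _)    (no _)           = z≤n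
    term≤ v (no v∉S)  (yes (indS+v , _)) = ≤-reflexive (sym (𝟙-yes (v ∈? ∁ (S ∪ N S))
      (x∉p⇒x∈∁p λ v∈S∪N → [ v∉S , independent-insert⇒∉N S v indS+v ] (x∈p∪q⁻ S (N S) v∈S∪N))))

  Σ-insert-χ≡0 : ∀ k S → ¬ (Independent G S × ∣ S ∣ ≡ k) → Σ-insert (χ (k + 1)) S ≡ 0
  Σ-insert-χ≡0 k S ¬indS = n≤0⇒n≡0 (≤-trans
    (sum-mono-≤ (λ v → term≤0 v (v ∈? S) (independentOfSize? (k + 1) (S [ v ]≔ true))))
    (≤-reflexive (sum-replicate-zero n)))
    where
    term≤0 : ∀ v (v∈?S : Dec (v ∈ S)) (d : Dec (Independent G (S [ v ]≔ true) × ∣ S [ v ]≔ true ∣ ≡ k + 1)) →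
      (if does v∈?S then 0 else 𝟙 d) ≤ 0
    term≤0 v (yes _)  _           = z≤n
    term≤0 v (no _)   (no _)      = z≤n
    term≤0 v (no v∉S) (yes S+v-ok) = contradiction (insert-independentOfSize⁻ S v v∉S S+v-ok) ¬indS

  module _ (qr : QuasiRegularizable G) where

    ∣∁[S∪N]∣≤n∸2k : ∀ {k S} → Independent G S → ∣ S ∣ ≡ k → ∣ ∁ (S ∪ N S) ∣ ≤ n ∸ 2 * k
    ∣∁[S∪N]∣≤n∸2k {k} {S} indS ∣S∣≡k = begin
      ∣ ∁ (S ∪ N S) ∣          ≡⟨ ∣∁p∣≡n∸∣p∣ (S ∪ N S) ⟩
      n ∸ ∣ S ∪ N S ∣          ≡⟨ cong (n ∸_) (∣p∪q∣≡∣p∣+∣q∣ S (N S) (independent⇒S∩N≡∅ indS)) ⟩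
      n ∸ (∣ S ∣ + ∣ N S ∣)    ≤⟨ ∸-monoʳ-≤ n (+-mono-≤ (≤-reflexive (sym ∣S∣≡k)) k≤∣N∣) ⟩
      n ∸ (k + k)              ≡⟨ cong (λ m → n ∸ (k + m)) (+-identityʳ k) ⟨
      n ∸ 2 * k                ∎
      where
      open ≤-Reasoning
      k≤∣N∣ : k ≤ ∣ N S ∣
      k≤∣N∣ = subst (_≤ ∣ N S ∣) ∣S∣≡k (qr S indS (N S) λ v → ∈N⁻ , ∈N⁺)

    Σ-insert-χ≤ : ∀ k S → Σ-insert (χ (k + 1)) S ≤ (n ∸ 2 * k) * χ k S
    Σ-insert-χ≤ k S = bound (independentOfSize? k S)
      where
      bound : (d : Dec (Independent G S × ∣ S ∣ ≡ k)) → Σ-insert (χ (k + 1)) S ≤ (n ∸ 2 * k) * 𝟙 d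
      bound (yes (indS , ∣S∣≡k)) = ≤-trans (Σ-insert-χ≤∣∁[S∪N]∣ k S)
        (≤-trans (∣∁[S∪N]∣≤n∸2k indS ∣S∣≡k) (≤-reflexive (sym (*-identityʳ (n ∸ 2 * k)))))
      bound (no ¬indS) = ≤-reflexive (trans (Σ-insert-χ≡0 k S ¬indS) (sym (*-zeroʳ (n ∸ 2 * k))))

    [k+1]*indepCount[k+1]≤[n∸2k]*indepCount[k] : ∀ k →
      (k + 1) * indepCount G (k + 1) ≤ (n ∸ 2 * k) * indepCount G k
    [k+1]*indepCount[k+1]≤[n∸2k]*indepCount[k] k = begin
      (k + 1) * indepCount G (k + 1)      ≡⟨ cong ((k + 1) *_) (indepCount≡Σˢχ (k + 1)) ⟩
      (k + 1) * Σˢ (χ (k + 1))            ≡⟨ *-distribˡ-Σˢ (k + 1) (χ (k + 1)) ⟩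
      Σˢ (λ T → (k + 1) * χ (k + 1) T)    ≡⟨ Σˢ-cong (∣∣*χ≡*χ (k + 1)) ⟨
      Σˢ (λ T → ∣ T ∣ * χ (k + 1) T)      ≡⟨ Σˢ-∣∣*≡Σˢ-Σ-insert (χ (k + 1)) ⟩
      Σˢ (Σ-insert (χ (k + 1)))           ≤⟨ Σˢ-mono-≤ (Σ-insert-χ≤ k) ⟩
      Σˢ (λ S → (n ∸ 2 * k) * χ k S)      ≡⟨ *-distribˡ-Σˢ (n ∸ 2 * k) (χ k) ⟨
      (n ∸ 2 * k) * Σˢ (χ k)              ≡⟨ cong ((n ∸ 2 * k) *_) (indepCount≡Σˢχ k) ⟨
      (n ∸ 2 * k) * indepCount G k        ∎
      where open ≤-Reasoning

mainTheorem2 : ∀ {n} (G : Graph n) (α : ℕ) → n ≥ 2 → QuasiRegularizable G →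
    IsIndependenceNumber G α →
    (∀ k → 1 ≤ k → k < α → (k + 1) * indepCount G (k + 1) ≤ (n ∸ 2 * k) * indepCount G k)
    × (∀ k → ⌈ n ∸ 1 /3⌉ ≤ k → k < α → indepCount G (k + 1) ≤ indepCount G k)
mainTheorem2 {n} G _ _ qr _ = (λ k _ _ → ratio k) , λ k ⌈n∸1/3⌉≤k _ →
  *-cancelˡ-≤ (k + 1) {{>-nonZero (m≤n+m 1 k)}} (begin
    (k + 1) * indepCount G (k + 1)  ≤⟨ ratio k ⟩
    (n ∸ 2 * k) * indepCount G k    ≤⟨ *-monoˡ-≤ (indepCount G k) (⌈n∸1/3⌉≤k⇒n∸2k≤k+1 n k ⌈n∸1/3⌉≤k) ⟩
    (k + 1) * indepCount G k        ∎)
  where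
  open ≤-Reasoning
  ratio : ∀ k → (k + 1) * indepCount G (k + 1) ≤ (n ∸ 2 * k) * indepCount G k
  ratio = [k+1]*indepCount[k+1]≤[n∸2k]*indepCount[k] G qr
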